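{- Let $k$ be a positive integer. Let $T$ be a tournament of order $m\ge 4k$ and let $(v_1,\dots,v_m)$ be a local median order of $T$. Then there are at least $k$ internally disjoint directed $2$-out-paths with origin $v_1$ and pairwise distinct termini in $\{v_{m-4k+2},\dots,v_m\}$.
   Context: A tournament is an orientation of a complete graph; $u$ dominates $v$ if $uv$ is an arc. A local median order of $T$ is an ordering $(v_1,\dots,v_m)$ of its vertices such that for all $1\le i<j\le m$, $v_i$ dominates at least half of $v_{i+1},\dots,v_j$ and $v_j$ is dominated by at least half of $v_i,\dots,v_{j-1}$. A directed $2$-out-path with origin $x$ and terminus $z$ is a path $(x,y,z)$ with arcs $xy$ and $yz$; paths are internally disjoint if their internal vertices are pairwise distinct and not on the other paths. -}

module Defs where

open import Data.Nat using (ℕ; zero; suc; _+_; _*_; _∸_; _≤_; _<_; _<ᵇ_; _≤ᵇ_)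
open import Data.Fin using (Fin; toℕ)
open import Data.Bool using (Bool; true; false; _∧_)
open import Data.List using (List; filterᵇ; length; allFin)
open import Data.Product using (_×_; _,_)
open import Data.Sum using (_⊎_)
open import Relation.Binary.PropositionalEquality using (_≡_)
open import Relation.Nullary using (¬_)
open import Function.Bundles using (_↔_; Inverse)

record Tournament (m : ℕ) : Set where
  field
    dom      : Fin m → Fin m → Bool
    irrefl   : ∀ u → dom u u ≡ false
    complete : ∀ u v → ¬ (u ≡ v) →
               (dom u v ≡ true × dom v u ≡ false) ⊎ (dom u v ≡ false × dom v u ≡ true)
open Tournament public

-- An ordering (v_1,…,v_m) of the vertices: a bijection from positions to vertices.
-- Positions are 0-indexed: position p (toℕ p = p) corresponds to v_{p+1}.
Ordering : ℕ → Set
Ordering m = Fin m ↔ Fin m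

countIn : ∀ {m} → ℕ → ℕ → (Fin m → Bool) → ℕ
countIn a b P = length (filterᵇ (λ l → (a <ᵇ toℕ l) ∧ (toℕ l ≤ᵇ b) ∧ P l) (allFin _))

countIn' : ∀ {m} → ℕ → ℕ → (Fin m → Bool) → ℕ
countIn' a b P = length (filterᵇ (λ l → (a ≤ᵇ toℕ l) ∧ (toℕ l <ᵇ b) ∧ P l) (allFin _))

IsLocalMedianOrder : ∀ {m} → Tournament m → Ordering m → Set
IsLocalMedianOrder {m} T σ =
  ∀ (i j : Fin m) → toℕ i < toℕ j →
    (toℕ j ∸ toℕ i ≤ 2 * countIn (toℕ i) (toℕ j) (λ l → dom T (v i) (v l)))
    × (toℕ j ∸ toℕ i ≤ 2 * countIn' (toℕ i) (toℕ j) (λ l → dom T (v l) (v j)))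
  where v = Inverse.to σ

record DisjointTwoOutPaths {m} (T : Tournament m) (k : ℕ) (x : Fin m) (S : Fin m → Set) : Set where
  field
    mid      : Fin k → Fin m
    term     : Fin k → Fin m
    arc₁     : ∀ a → dom T x (mid a) ≡ true
    arc₂     : ∀ a → dom T (mid a) (term a) ≡ true
    -- paths have distinct vertices (x ≠ y, y ≠ z follow from irreflexivity; x ≠ z required)
    termNotOrigin : ∀ a → ¬ (term a ≡ x)
    midDistinct   : ∀ a b → mid a ≡ mid b → a ≡ b
    midNotTerm    : ∀ a b → mid a ≡ term b → a ≡ b
    termDistinct  : ∀ a b → term a ≡ term b → a ≡ b
    termIn        : ∀ a → S (term a)

-- Write x = v₁ and scan the candidate termini v_t for t = m, m − 1, …, m − 4k + 2.  Unless
-- v_t is already the middle vertex of a path, give it a new path x → y → v_t through an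
-- unused out-neighbour y of x below v_t, preferably y = v_{t−1}, which dominates v_t by the
-- median property.  If no such y exists, every out-neighbour of x among v₂, …, v_{t−1} that
-- dominates v_t is a used middle vertex.  Since x dominates at least half of all vertices,
-- at most 2·#skips + 1 of them above v_t, and v_t is dominated by at least half of
-- v₂, …, v_{t−1}, inclusion–exclusion then gives m ≤ t + 4·#paths + O(1).  At the end of
-- the scan this forces k paths.

module Submission where

open import Defs
open import Data.Bool using (Bool; true; false; _∧_; _∨_; not; T)
open import Data.Bool.Properties using (T-≡; T-∨; ¬-not; ∧-assoc; ∧-comm; ∧-zeroʳ; ∧-identityʳ)
import Data.Bool as Bool
open import Data.Empty using (⊥-elim)
open import Data.Fin using (Fin; zero; suc; toℕ; fromℕ<; inject≤)
open import Data.Fin.Properties using (toℕ-fromℕ<; toℕ-injective; toℕ<n; inject≤-injective)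
open import Data.List using (length; filterᵇ; tabulate)
import Data.List as List
open import Data.Nat hiding (Ordering)
open import Data.Nat.DivMod using (_mod_; m<n⇒m%n≡m)
open import Data.Nat.Properties
open import Data.Nat.Tactic.RingSolver using (solve-∀)
open import Algebra.Properties.CommutativeSemigroup +-commutativeSemigroup using (interchange; xy∙z≈xz∙y)
open import Data.Product using (Σ-syntax; ∃; _×_; _,_; proj₁; proj₂; map)
open import Data.Sum using (_⊎_; inj₁; inj₂)
open import Data.Vec.Functional using (Vector; _∷_; head; tail)
open import Function.Base using (_∘_)
open import Function.Bundles using (Inverse; Injection; Equivalence)
open import Function.Properties.Inverse using (↔⇒↣)
open import Relation.Binary.PropositionalEquality
open import Relation.Nullary using (yes; no; contradiction)

bit : Bool → ℕ
bit false = 0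
bit true  = 1

bit≤1 : ∀ b → bit b ≤ 1
bit≤1 false = z≤n
bit≤1 true  = ≤-refl

+bit-false : ∀ {b} N → b ≡ false → N + bit b ≡ N
+bit-false N refl = +-identityʳ N

∧-swap : ∀ a b c → a ∧ (b ∧ c) ≡ b ∧ (a ∧ c)
∧-swap a b c = trans (sym (∧-assoc a b c)) (trans (cong (_∧ c) (∧-comm a b)) (∧-assoc b a c))

∧-not-false : ∀ {a b} → a ∧ not b ≡ false → a ≡ true → b ≡ true
∧-not-false {b = true}  _ _ = refl
∧-not-false {b = false} () refl

∧-not-∨ : ∀ a b c → a ∧ not b ≡ false → a ∧ not (c ∨ b) ≡ false
∧-not-∨ false b c     _ = refl
∧-not-∨ true  b true  _ = refl
∧-not-∨ true  b false h = h

∧-not-true : ∀ {a b} → a ∧ not b ≡ true → a ≡ true × b ≡ false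
∧-not-true {true} {false} _ = refl , refl
∧-not-true {true} {true} ()
∧-not-true {false} ()

∧≡true : ∀ {a b} → a ∧ b ≡ true → a ≡ true × b ≡ true
∧≡true {true} {true} _ = refl , refl
∧≡true {true} {false} ()
∧≡true {false} ()

≡true⇒T : ∀ {b} → b ≡ true → T b
≡true⇒T = Equivalence.from T-≡

T⇒≡true : ∀ {b} → T b → b ≡ true
T⇒≡true = Equivalence.to T-≡

count : (ℕ → Bool) → ℕ → ℕ
count Q zero    = 0
count Q (suc n) = count Q n + bit (Q n)

count-cons : ∀ Q n → count Q (suc n) ≡ bit (Q 0) + count (Q ∘ suc) n
count-cons Q zero    = +-comm 0 (bit (Q 0))
count-cons Q (suc n) = begin
  count Q (suc n) + bit (Q (suc n))                ≡⟨ cong (_+ bit (Q (suc n))) (count-cons Q n) ⟩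
  bit (Q 0) + count (Q ∘ suc) n + bit (Q (suc n))  ≡⟨ +-assoc (bit (Q 0)) _ _ ⟩
  bit (Q 0) + count (Q ∘ suc) (suc n)              ∎
  where open ≡-Reasoning

count-cong : ∀ {Q R} n → (∀ p → p < n → Q p ≡ R p) → count Q n ≡ count R n
count-cong zero    eq = refl
count-cong (suc n) eq = cong₂ _+_ (count-cong n (λ p → eq p ∘ m<n⇒m<1+n)) (cong bit (eq n ≤-refl))

count-mono : ∀ {Q R} n → (∀ p → p < n → Q p ≡ true → R p ≡ true) → count Q n ≤ count R n
count-mono zero    imp = z≤n
count-mono (suc n) imp = +-mono-≤ (count-mono n (λ p → imp p ∘ m<n⇒m<1+n)) (bit-mono (imp n ≤-refl))
  where
  bit-mono : ∀ {a b} → (a ≡ true → b ≡ true) → bit a ≤ bit b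
  bit-mono {false} _   = z≤n
  bit-mono {true}  a⇒b rewrite a⇒b refl = ≤-refl

count≤ : ∀ Q n → count Q n ≤ n
count≤ Q zero    = z≤n
count≤ Q (suc n) = subst (count Q n + bit (Q n) ≤_) (+-comm n 1) (+-mono-≤ (count≤ Q n) (bit≤1 (Q n)))

count≤pred : ∀ {Q} n → Q 0 ≡ false → count Q (suc n) ≤ n
count≤pred {Q} n Q0 = begin
  count Q (suc n)              ≡⟨ count-cons Q n ⟩
  bit (Q 0) + count (Q ∘ suc) n ≡⟨ cong (λ b → bit b + count (Q ∘ suc) n) Q0 ⟩
  count (Q ∘ suc) n            ≤⟨ count≤ (Q ∘ suc) n ⟩
  n                            ∎
  where open ≤-Reasoning

count-≡0 : ∀ {Q} n → (∀ p → p < n → Q p ≡ false) → count Q n ≡ 0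
count-≡0 zero    _   = refl
count-≡0 (suc n) all = trans (+bit-false _ (all n ≤-refl)) (count-≡0 n (λ p → all p ∘ m<n⇒m<1+n))

count-pos : ∀ {Q} n → 0 < count Q n → ∃ λ p → p < n × Q p ≡ true
count-pos {Q} (suc n) pos with Q n in Qn
... | true  = n , ≤-refl , Qn
... | false with count-pos n (subst (0 <_) (+-identityʳ _) pos)
...   | p , p<n , Qp = p , m<n⇒m<1+n p<n , Qp

count-∧+∨ : ∀ Q R n →
  count Q n + count R n ≡ count (λ p → Q p ∧ R p) n + count (λ p → Q p ∨ R p) n
count-∧+∨ Q R zero    = refl
count-∧+∨ Q R (suc n) = begin
  cQ + bit (Q n) + (cR + bit (R n))                  ≡⟨ interchange cQ (bit (Q n)) cR _ ⟩
  cQ + cR + (bit (Q n) + bit (R n))                  ≡⟨ cong₂ _+_ (count-∧+∨ Q R n) (bit-∧+∨ (Q n) (R n)) ⟩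
  cQ∧R + cQ∨R + (bit (Q n ∧ R n) + bit (Q n ∨ R n))  ≡⟨ interchange cQ∧R cQ∨R (bit (Q n ∧ R n)) _ ⟩
  cQ∧R + bit (Q n ∧ R n) + (cQ∨R + bit (Q n ∨ R n))  ∎
  where
  open ≡-Reasoning
  cQ cR cQ∧R cQ∨R : ℕ
  cQ   = count Q n
  cR   = count R n
  cQ∧R = count (λ p → Q p ∧ R p) n
  cQ∨R = count (λ p → Q p ∨ R p) n
  bit-∧+∨ : ∀ a b → bit a + bit b ≡ bit (a ∧ b) + bit (a ∨ b)
  bit-∧+∨ true  true  = refl
  bit-∧+∨ true  false = refl
  bit-∧+∨ false b     = refl

count-∨ : ∀ Q R n → count (λ p → Q p ∨ R p) n ≤ count Q n + count R n
count-∨ Q R n = subst (count (λ p → Q p ∨ R p) n ≤_) (sym (count-∧+∨ Q R n)) (m≤n+m _ _)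

≢⇒≡ᵇ-false : ∀ {p q} → p ≢ q → (p ≡ᵇ q) ≡ false
≢⇒≡ᵇ-false {p} {q} p≢q = ¬-not (p≢q ∘ ≡ᵇ⇒≡ p q ∘ ≡true⇒T)

count-≡ᵇ≤1 : ∀ q n → count (q ≡ᵇ_) n ≤ 1
count-≡ᵇ≤1 q zero = z≤n
count-≡ᵇ≤1 q (suc n) with q ≡ᵇ n in q≡ᵇn
... | false = subst (_≤ 1) (sym (+-identityʳ _)) (count-≡ᵇ≤1 q n)
... | true  = ≤-reflexive (cong (_+ 1) (count-≡0 n (λ p p<n → ≢⇒≡ᵇ-false (q≢p p<n))))
  where
  q≢p : ∀ {p} → p < n → q ≢ p
  q≢p p<n refl = <-irrefl (≡ᵇ⇒≡ q n (≡true⇒T q≡ᵇn)) p<n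

count-<ᵇ : ∀ Q t d → count (λ p → (p <ᵇ t) ∧ Q p) (d + t) ≡ count Q t
count-<ᵇ Q t zero    = count-cong t (λ p p<t → cong (_∧ Q p) (T⇒≡true (<⇒<ᵇ p<t)))
count-<ᵇ Q t (suc d) = trans (+bit-false _ d+t≮ᵇt) (count-<ᵇ Q t d)
  where
  d+t≮ᵇt : ((d + t <ᵇ t) ∧ Q (d + t)) ≡ false
  d+t≮ᵇt = cong (_∧ Q (d + t)) (¬-not λ lt → <⇒≱ (<ᵇ⇒< _ _ (≡true⇒T lt)) (m≤n+m t d))

length-filterᵇ-tabulate : ∀ {A : Set} {n} (P : A → Bool) (f : Fin n → A) (Q : ℕ → Bool) →
  (∀ i → P (f i) ≡ Q (toℕ i)) → length (filterᵇ P (tabulate f)) ≡ count Q n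
length-filterᵇ-tabulate {n = zero}  P f Q eq = refl
length-filterᵇ-tabulate {n = suc n} P f Q eq = begin
  length (filterᵇ P (f zero List.∷ tabulate (f ∘ suc)))
    ≡⟨ length-filterᵇ-∷ (f zero) (tabulate (f ∘ suc)) ⟩
  bit (P (f zero)) + length (filterᵇ P (tabulate (f ∘ suc)))
    ≡⟨ cong₂ _+_ (cong bit (eq zero)) (length-filterᵇ-tabulate P (f ∘ suc) (Q ∘ suc) (eq ∘ suc)) ⟩
  bit (Q 0) + count (Q ∘ suc) n
    ≡⟨ count-cons Q n ⟨
  count Q (suc n)
    ∎
  where
  open ≡-Reasoning
  length-filterᵇ-∷ : ∀ x xs →
    length (filterᵇ P (x List.∷ xs)) ≡ bit (P x) + length (filterᵇ P xs)
  length-filterᵇ-∷ x xs with P x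
  ... | true  = refl
  ... | false = refl

occurs : ∀ {a} → Vector ℕ a → ℕ → Bool
occurs {zero}  f q = false
occurs {suc a} f q = (head f ≡ᵇ q) ∨ occurs (tail f) q

occurs-∋ : ∀ {a} (f : Vector ℕ a) i → T (occurs f (f i))
occurs-∋ f zero    = Equivalence.from T-∨ (inj₁ (≡⇒≡ᵇ (f zero) (f zero) refl))
occurs-∋ f (suc i) = Equivalence.from T-∨ (inj₂ (occurs-∋ (tail f) i))

occurs≡false⇒≢ : ∀ {a} (f : Vector ℕ a) {q} → occurs f q ≡ false → ∀ i → f i ≢ q
occurs≡false⇒≢ f ¬occ i refl = subst T ¬occ (occurs-∋ f i)

-- Positions 0, 1, …, n index the vertices v₁, …, v_{n+1}; the origin of every path is
-- position 0 and `arc p q` says that the vertex at p dominates the vertex at q.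
module GreedyPaths
  (n : ℕ) (arc : ℕ → ℕ → Bool)
  (arc-0-0 : arc 0 0 ≡ false)
  (out-half : n ≤ 2 * count (arc 0) (suc n))
  (arc-suc : ∀ {u} → suc u ≤ n → arc u (suc u) ≡ true)
  (in-half : ∀ {u} → suc u ≤ n → u ≤ 2 * count (λ p → (1 ≤ᵇ p) ∧ arc p (suc u)) (suc u))
  where

  out : ℕ → Bool
  out = arc 0

  inArc : ℕ → ℕ → Bool
  inArc t p = (1 ≤ᵇ p) ∧ arc p t

  record Paths (t : ℕ) : Set where
    field
      size           : ℕ
      mid term       : Vector ℕ size
      out-mid        : ∀ i → out (mid i) ≡ true
      arc-mid-term   : ∀ i → arc (mid i) (term i) ≡ true
      mid<term       : ∀ i → mid i < term i
      t<term         : ∀ i → t < term i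
      term≤n         : ∀ i → term i ≤ n
      mid-injective  : ∀ i j → mid i ≡ mid j → i ≡ j
      term-injective : ∀ i j → term i ≡ term j → i ≡ j
      mid≢term       : ∀ i j → mid i ≢ term j

    isMid : ℕ → Bool
    isMid = occurs mid

  lower : ∀ {u} → Paths (suc u) → Paths u
  lower {u} P = record { Old hiding (t<term) ; t<term = λ i → <-trans (n<1+n u) (Old.t<term i) }
    where module Old = Paths P

  extend : ∀ {u p} (P : Paths (suc u)) → suc u ≤ n → p < suc u →
           out p ≡ true → arc p (suc u) ≡ true →
           Paths.isMid P p ≡ false → Paths.isMid P (suc u) ≡ false → Paths u
  extend {u} {p} P t≤n p<t out-p arc-p-t p-unused t-unused = record
    { size           = suc size
    ; mid            = p ∷ mid
    ; term           = suc u ∷ term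
    ; out-mid        = λ { zero → out-p   ; (suc i) → out-mid i }
    ; arc-mid-term   = λ { zero → arc-p-t ; (suc i) → arc-mid-term i }
    ; mid<term       = λ { zero → p<t     ; (suc i) → mid<term i }
    ; t<term         = λ { zero → ≤-refl  ; (suc i) → <-trans (n<1+n u) (t<term i) }
    ; term≤n         = λ { zero → t≤n     ; (suc i) → term≤n i }
    ; mid-injective  = mid-injective′
    ; term-injective = term-injective′
    ; mid≢term       = mid≢term′
    }
    where
    open Paths P
    mid-injective′ : ∀ i j → (p ∷ mid) i ≡ (p ∷ mid) j → i ≡ j
    mid-injective′ zero    zero    _ = refl
    mid-injective′ zero    (suc j) e = ⊥-elim (occurs≡false⇒≢ mid p-unused j (sym e))
    mid-injective′ (suc i) zero    e = ⊥-elim (occurs≡false⇒≢ mid p-unused i e)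
    mid-injective′ (suc i) (suc j) e = cong suc (mid-injective i j e)
    term-injective′ : ∀ i j → (suc u ∷ term) i ≡ (suc u ∷ term) j → i ≡ j
    term-injective′ zero    zero    _ = refl
    term-injective′ zero    (suc j) e = ⊥-elim (<-irrefl e (t<term j))
    term-injective′ (suc i) zero    e = ⊥-elim (<-irrefl (sym e) (t<term i))
    term-injective′ (suc i) (suc j) e = cong suc (term-injective i j e)
    mid≢term′ : ∀ i j → (p ∷ mid) i ≢ (suc u ∷ term) j
    mid≢term′ zero    zero    = <⇒≢ p<t
    mid≢term′ zero    (suc j) = <⇒≢ (<-trans p<t (t<term j))
    mid≢term′ (suc i) zero    = occurs≡false⇒≢ mid t-unused i
    mid≢term′ (suc i) (suc j) = mid≢term i j

  -- `skipped` counts the candidates passed over because they already were middle vertices.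
  -- Out-neighbours of x accumulate above the scan position only at skips, at most two per
  -- skip: every other step leaves the next candidate unused only if x does not dominate it.
  record Greedy (t : ℕ) : Set where
    field
      paths   : Paths t
      skipped : ℕ
    open Paths paths public
    field
      length-bound : n ≤ t + 2 * (size + skipped) + 2
      mid-bound    : count isMid (suc t) + skipped ≤ size
      out-bound    : count out (suc n) + bit (out t ∧ not (isMid t))
                       ≤ count out (suc t) + suc (2 * skipped)

  start : Greedy n
  start = record
    { paths = record
      { size = 0 ; mid = λ () ; term = λ () ; out-mid = λ () ; arc-mid-term = λ ()
      ; mid<term = λ () ; t<term = λ () ; term≤n = λ ()
      ; mid-injective = λ () ; term-injective = λ () ; mid≢term = λ () }
    ; skipped      = 0
    ; length-bound = ≤-trans (m≤m+n n 0) (m≤m+n _ 2)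
    ; mid-bound    = ≤-reflexive (trans (+-identityʳ _) (count-≡0 (suc n) (λ _ _ → refl)))
    ; out-bound    = +-monoʳ-≤ (count out (suc n)) (bit≤1 _)
    }

  length-bound-step : ∀ {u c c′} → c′ ≡ suc c → n ≤ suc u + 2 * c + 2 → n ≤ u + 2 * c′ + 2
  length-bound-step {u} {c} refl h = ≤-trans h (≤-trans (m≤m+n _ 1) (≤-reflexive (shift u c)))
    where
    shift : ∀ u c → suc u + 2 * c + 2 + 1 ≡ u + 2 * suc c + 2
    shift = solve-∀

  out-bound-unused : ∀ {u} (G : Greedy (suc u)) → Greedy.isMid G (suc u) ≡ false →
    count out (suc n) ≤ count out (suc u) + suc (2 * Greedy.skipped G)
  out-bound-unused {u} G t-unused = +-cancelʳ-≤ (bit (out (suc u))) _ _ (begin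
    count out (suc n) + bit (out (suc u))                        ≡⟨ cong (λ b → count out (suc n) + bit b) out-t ⟨
    count out (suc n) + bit (out (suc u) ∧ not (isMid (suc u)))  ≤⟨ out-bound ⟩
    count out (suc u) + bit (out (suc u)) + suc (2 * skipped)    ≡⟨ xy∙z≈xz∙y (count out (suc u)) _ _ ⟩
    count out (suc u) + suc (2 * skipped) + bit (out (suc u))    ∎)
    where
    open Greedy G
    open ≤-Reasoning
    out-t : out (suc u) ∧ not (isMid (suc u)) ≡ out (suc u)
    out-t = trans (cong (λ b → out (suc u) ∧ not b) t-unused) (∧-identityʳ _)

  skip : ∀ {u} (G : Greedy (suc u)) → Greedy.isMid G (suc u) ≡ true → Greedy u
  skip {u} G t-used = record
    { paths        = lower paths
    ; skipped      = suc skipped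
    ; length-bound = length-bound-step {u} (+-suc size skipped) length-bound
    ; mid-bound    = ≤-trans (≤-reflexive reassoc) mid-bound
    ; out-bound    = out-bound′ (bit≤1 (out (suc u))) (bit≤1 (out u ∧ not (isMid u)))
                       (≤-trans (≤-reflexive (sym (+bit-false _ t-blocked))) out-bound)
    }
    where
    open Greedy G
    t-blocked : out (suc u) ∧ not (isMid (suc u)) ≡ false
    t-blocked = trans (cong (λ b → out (suc u) ∧ not b) t-used) (∧-zeroʳ _)
    reassoc : count isMid (suc u) + suc skipped ≡ count isMid (suc (suc u)) + skipped
    reassoc = trans (sym (+-assoc (count isMid (suc u)) 1 skipped))
                    (cong (λ b → count isMid (suc u) + bit b + skipped) (sym t-used))
    out-bound′ : ∀ {N P b b′ K} → b ≤ 1 → b′ ≤ 1 →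
                 N ≤ P + b + suc (2 * K) → N + b′ ≤ P + suc (2 * suc K)
    out-bound′ {N} {P} {b} {b′} {K} b≤1 b′≤1 h = begin
      N + b′                  ≤⟨ +-mono-≤ h b′≤1 ⟩
      P + b + suc (2 * K) + 1 ≤⟨ +-monoˡ-≤ 1 (+-monoˡ-≤ (suc (2 * K)) (+-monoʳ-≤ P b≤1)) ⟩
      P + 1 + suc (2 * K) + 1 ≡⟨ shift P K ⟩
      P + suc (2 * suc K)     ∎
      where
      open ≤-Reasoning
      shift : ∀ P K → P + 1 + suc (2 * K) + 1 ≡ P + suc (2 * suc K)
      shift = solve-∀

  addPath : ∀ {u p} (G : Greedy (suc u)) → suc u ≤ n → p < suc u →
            out p ≡ true → arc p (suc u) ≡ true → Greedy.isMid G p ≡ false → Greedy.isMid G (suc u) ≡ false →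
            p ≡ u ⊎ out u ∧ not (Greedy.isMid G u) ≡ false → Greedy u
  addPath {u} {p} G t≤n p<t out-p arc-p-t p-unused t-unused u-blocked = record
    { paths        = extended
    ; skipped      = skipped
    ; length-bound = length-bound-step {u} refl length-bound
    ; mid-bound    = ≤-trans (+-monoˡ-≤ skipped mids-below) (s≤s mid-bound)
    ; out-bound    = ≤-trans (≤-reflexive (+bit-false _ (blocked u-blocked))) (out-bound-unused G t-unused)
    }
    where
    open Greedy G
    extended : Paths u
    extended = extend paths t≤n p<t out-p arc-p-t p-unused t-unused
    mids-below : count (Paths.isMid extended) (suc u) ≤ suc (count isMid (suc (suc u)))
    mids-below = ≤-trans (count-∨ (p ≡ᵇ_) isMid (suc u))
                         (+-mono-≤ (count-≡ᵇ≤1 p (suc u)) (m≤m+n _ (bit (isMid (suc u)))))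
    blocked : p ≡ u ⊎ out u ∧ not (isMid u) ≡ false →
              out u ∧ not (Paths.isMid extended u) ≡ false
    blocked (inj₁ p≡u) = trans (cong (λ b → out u ∧ not b) u-used) (∧-zeroʳ _)
      where
      u-used : Paths.isMid extended u ≡ true
      u-used = T⇒≡true (subst (T ∘ Paths.isMid extended) p≡u (occurs-∋ (p ∷ mid) zero))
    blocked (inj₂ h) = ∧-not-∨ (out u) (isMid u) (p ≡ᵇ u) h

  -- The counting step: with A = out-neighbours of x and B = in-neighbours of v_{u+1}
  -- among positions 1..u, |A ∩ B| ≤ #middle vertices, |A ∪ B| ≤ u, 2|B| ≥ u and
  -- 2|A| ≥ n − 2(2·skipped + 1).
  stuck-length-bound : ∀ {u N a K cA cB cA∩B cA∪B} →
    cA + cB ≡ cA∩B + cA∪B → cA∪B ≤ u → u ≤ 2 * cB → cA∩B + K ≤ a →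
    N ≤ cA + suc (2 * K) → n ≤ 2 * N → n ≤ u + 2 * (a + K) + 2
  stuck-length-bound {u} {N} {a} {K} {cA} {cB} {cA∩B} {cA∪B} incl-excl ∪≤u u≤2B ∩≤ N≤ n≤2N =
    begin
    n                                 ≤⟨ n≤2N ⟩
    2 * N                             ≤⟨ *-monoʳ-≤ 2 N≤ ⟩
    2 * (cA + suc (2 * K))            ≡⟨ expand cA K ⟩
    2 * cA + (4 * K + 2)              ≤⟨ +-monoˡ-≤ (4 * K + 2) 2A≤ ⟩
    2 * cA∩B + u + (4 * K + 2)        ≡⟨ regroup cA∩B u K ⟩
    u + 2 * (cA∩B + K) + 2 * K + 2    ≤⟨ +-monoˡ-≤ 2 (+-monoˡ-≤ (2 * K) (+-monoʳ-≤ u (*-monoʳ-≤ 2 ∩≤))) ⟩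
    u + 2 * a + 2 * K + 2             ≡⟨ collect u a K ⟩
    u + 2 * (a + K) + 2               ∎
    where
    open ≤-Reasoning
    expand : ∀ x K → 2 * (x + suc (2 * K)) ≡ 2 * x + (4 * K + 2)
    expand = solve-∀
    regroup : ∀ x u K → 2 * x + u + (4 * K + 2) ≡ u + 2 * (x + K) + 2 * K + 2
    regroup = solve-∀
    collect : ∀ u a K → u + 2 * a + 2 * K + 2 ≡ u + 2 * (a + K) + 2
    collect = solve-∀
    2A≤ : 2 * cA ≤ 2 * cA∩B + u
    2A≤ = +-cancelʳ-≤ u _ _ (begin
      2 * cA + u             ≤⟨ +-monoʳ-≤ (2 * cA) u≤2B ⟩
      2 * cA + 2 * cB        ≡⟨ *-distribˡ-+ 2 cA cB ⟨
      2 * (cA + cB)          ≡⟨ cong (2 *_) incl-excl ⟩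
      2 * (cA∩B + cA∪B)      ≤⟨ *-monoʳ-≤ 2 (+-monoʳ-≤ cA∩B ∪≤u) ⟩
      2 * (cA∩B + u)         ≡⟨ split cA∩B u ⟩
      2 * cA∩B + u + u       ∎)
      where
      split : ∀ x u → 2 * (x + u) ≡ 2 * x + u + u
      split = solve-∀

  free : ∀ {t} → Greedy t → ℕ → ℕ → Bool
  free G t p = (out p ∧ inArc t p) ∧ not (Greedy.isMid G p)

  free-parts : ∀ {t u} (G : Greedy t) {p} → free G (suc u) p ≡ true →
    out p ≡ true × arc p (suc u) ≡ true × Greedy.isMid G p ≡ false
  free-parts G {p} p-free =
    let out∧in , unused = ∧-not-true {out p ∧ inArc _ p} p-free
        out-p , in-p    = ∧≡true {out p} out∧in
    in out-p , proj₂ (∧≡true {1 ≤ᵇ p} in-p) , unused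

  stuck : ∀ {u} (G : Greedy (suc u)) → suc u ≤ n → Greedy.isMid G (suc u) ≡ false →
          out u ∧ not (Greedy.isMid G u) ≡ false →
          (∀ p → p < suc u → free G (suc u) p ≡ false) → Greedy u
  stuck {u} G t≤n t-unused u-blocked none = record
    { paths        = lower paths
    ; skipped      = skipped
    ; length-bound = stuck-length-bound (count-∧+∨ out (inArc (suc u)) (suc u))
                       (count≤pred u (cong (_∨ false) arc-0-0)) (in-half t≤n)
                       (≤-trans (+-monoˡ-≤ skipped used-below) mid-bound)
                       (out-bound-unused G t-unused) out-half
    ; mid-bound    = ≤-trans (+-monoˡ-≤ skipped (m≤m+n _ _)) mid-bound
    ; out-bound    = ≤-trans (≤-reflexive (+bit-false _ u-blocked)) (out-bound-unused G t-unused)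
    }
    where
    open Greedy G
    used-below : count (λ p → out p ∧ inArc (suc u) p) (suc u) ≤ count isMid (suc (suc u))
    used-below = ≤-trans (count-mono (suc u) (λ p p<t → ∧-not-false (none p p<t))) (m≤m+n _ _)

  step : ∀ {u} → suc u ≤ n → Greedy (suc u) → Greedy u
  step {u} t≤n G with Greedy.isMid G (suc u) in t-used
  ... | true  = skip G t-used
  ... | false with out u ∧ not (Greedy.isMid G u) in u-free
  ...   | true  = addPath G t≤n ≤-refl (proj₁ u-parts) (arc-suc t≤n) (proj₂ u-parts) t-used (inj₁ refl)
    where u-parts = ∧-not-true u-free
  ...   | false with anyUpTo? (λ p → free G (suc u) p Bool.≟ true) (suc u)
  ...     | yes (p , p<t , p-free) =
              let out-p , arc-p-t , p-unused = free-parts G p-free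
              in addPath G t≤n p<t out-p arc-p-t p-unused t-used (inj₂ u-free)
  ...     | no none = stuck G t≤n t-used u-free (λ p p<t → ¬-not λ p-free → none (p , p<t , p-free))

  reach : ∀ d {t} → d + t ≡ n → Greedy t
  reach zero    t≡n = subst Greedy (sym t≡n) start
  reach (suc d) {t} d+t≡n = step (subst (suc t ≤_) d+t+1≡n (m≤n+m (suc t) d)) (reach d d+t+1≡n)
    where
    d+t+1≡n : d + suc t ≡ n
    d+t+1≡n = trans (+-suc d t) d+t≡n

  paths-above : ∀ {s} → s ≤ n → Σ[ P ∈ Paths s ] n ≤ s + 4 * Paths.size P + 2
  paths-above {s} s≤n = paths , ≤-trans length-bound (+-monoˡ-≤ 2 (+-monoʳ-≤ s (begin
    2 * (size + skipped) ≤⟨ *-monoʳ-≤ 2 (+-monoʳ-≤ size (≤-trans (m≤n+m skipped _) mid-bound)) ⟩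
    2 * (size + size)    ≡⟨ double size ⟩
    4 * size             ∎)))
    where
    open Greedy (reach (n ∸ s) (m∸n+n≡m s≤n))
    open ≤-Reasoning
    double : ∀ a → 2 * (a + a) ≡ 4 * a
    double = solve-∀

module LocalMedianOrder
  {n} (T : Tournament (suc n)) (σ : Ordering (suc n)) (lmo : IsLocalMedianOrder T σ) where

  v : Fin (suc n) → Fin (suc n)
  v = Inverse.to σ

  -- `mod` makes `pos` total; only its values below n + 1 matter.
  pos : ℕ → Fin (suc n)
  pos p = p mod suc n

  toℕ-pos : ∀ {p} → p < suc n → toℕ (pos p) ≡ p
  toℕ-pos p<n = trans (toℕ-fromℕ< _) (m<n⇒m%n≡m p<n)

  pos-toℕ : ∀ l → pos (toℕ l) ≡ l
  pos-toℕ l = toℕ-injective (toℕ-pos (toℕ<n l))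

  v∘pos-injective : ∀ {p q} → p < suc n → q < suc n → v (pos p) ≡ v (pos q) → p ≡ q
  v∘pos-injective p<n q<n e =
    trans (sym (toℕ-pos p<n)) (trans (cong toℕ (Injection.injective (↔⇒↣ σ) e)) (toℕ-pos q<n))

  arc : ℕ → ℕ → Bool
  arc p q = dom T (v (pos p)) (v (pos q))

  arc-0-0 : arc 0 0 ≡ false
  arc-0-0 = irrefl T (v zero)

  countIn≡count : ∀ a b (P : Fin (suc n) → Bool) →
    countIn a b P ≡ count (λ p → (a <ᵇ p) ∧ (p ≤ᵇ b) ∧ P (pos p)) (suc n)
  countIn≡count a b P = length-filterᵇ-tabulate _ (λ l → l) _
    (λ l → cong (λ l′ → (a <ᵇ toℕ l) ∧ (toℕ l ≤ᵇ b) ∧ P l′) (sym (pos-toℕ l)))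

  countIn′≡count : ∀ a b (P : Fin (suc n) → Bool) →
    countIn' a b P ≡ count (λ p → (a ≤ᵇ p) ∧ (p <ᵇ b) ∧ P (pos p)) (suc n)
  countIn′≡count a b P = length-filterᵇ-tabulate _ (λ l → l) _
    (λ l → cong (λ l′ → (a ≤ᵇ toℕ l) ∧ (toℕ l <ᵇ b) ∧ P l′) (sym (pos-toℕ l)))

  median : ∀ {i j} → i < j → j ≤ n →
    (j ∸ i ≤ 2 * count (λ p → (i <ᵇ p) ∧ (p ≤ᵇ j) ∧ arc i p) (suc n)) ×
    (j ∸ i ≤ 2 * count (λ p → (i ≤ᵇ p) ∧ (p <ᵇ j) ∧ arc p j) (suc n))
  median {i} {j} i<j j≤n = map (subst (λ c → j ∸ i ≤ 2 * c) (countIn≡count i j _))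
                               (subst (λ c → j ∸ i ≤ 2 * c) (countIn′≡count i j _))
                               (subst₂ Window (toℕ-pos i<n) (toℕ-pos j<n) (lmo (pos i) (pos j) pos-i<pos-j))
    where
    j<n : j < suc n
    j<n = s≤s j≤n
    i<n : i < suc n
    i<n = <-trans i<j j<n
    pos-i<pos-j : toℕ (pos i) < toℕ (pos j)
    pos-i<pos-j = subst₂ _<_ (sym (toℕ-pos i<n)) (sym (toℕ-pos j<n)) i<j
    Window : ℕ → ℕ → Set
    Window a b = (b ∸ a ≤ 2 * countIn a b (λ l → dom T (v (pos i)) (v l)))
               × (b ∸ a ≤ 2 * countIn' a b (λ l → dom T (v l) (v (pos j))))

  out-half : n ≤ 2 * count (arc 0) (suc n)
  out-half with 1 ≤? n
  ... | no n≱1  = ≤-trans (≤-pred (≰⇒> n≱1)) z≤n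
  ... | yes 1≤n = subst (λ c → n ≤ 2 * c) (count-cong (suc n) drop-window) (proj₁ (median 1≤n ≤-refl))
    where
    drop-window : ∀ p → p < suc n → (0 <ᵇ p) ∧ (p ≤ᵇ n) ∧ arc 0 p ≡ arc 0 p
    drop-window zero    _     = sym arc-0-0
    drop-window (suc p) p<n+1 = cong (_∧ arc 0 (suc p)) (T⇒≡true (≤⇒≤ᵇ (≤-pred p<n+1)))

  arc-suc : ∀ {u} → suc u ≤ n → arc u (suc u) ≡ true
  arc-suc {u} t≤n =
    let p , _ , in-window = count-pos (suc n) (positive (≤-trans (≤-reflexive (sym (m+n∸n≡m 1 u)))
                                                                  (proj₁ (median ≤-refl t≤n))))
        u<ᵇp , rest     = ∧≡true in-window
        p≤ᵇt , arc-u-p  = ∧≡true rest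
        p≡t             = ≤-antisym (≤ᵇ⇒≤ p (suc u) (≡true⇒T p≤ᵇt)) (<ᵇ⇒< u p (≡true⇒T u<ᵇp))
    in subst (λ q → arc u q ≡ true) p≡t arc-u-p
    where
    positive : ∀ {c} → 1 ≤ 2 * c → 0 < c
    positive {suc c} _ = z<s

  in-half : ∀ {u} → suc u ≤ n → u ≤ 2 * count (λ p → (1 ≤ᵇ p) ∧ arc p (suc u)) (suc u)
  in-half {zero}  _   = z≤n
  in-half {suc w} t≤n = subst (λ c → suc w ≤ 2 * c) restrict (proj₂ (median (s≤s (s≤s z≤n)) t≤n))
    where
    t = suc (suc w)
    inArc-t : ℕ → Bool
    inArc-t p = (1 ≤ᵇ p) ∧ arc p t
    restrict : count (λ p → (1 ≤ᵇ p) ∧ (p <ᵇ t) ∧ arc p t) (suc n) ≡ count inArc-t t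
    restrict = begin
      count (λ p → (1 ≤ᵇ p) ∧ (p <ᵇ t) ∧ arc p t) (suc n)
        ≡⟨ count-cong (suc n) (λ p _ → ∧-swap (1 ≤ᵇ p) (p <ᵇ t) _) ⟩
      count (λ p → (p <ᵇ t) ∧ inArc-t p) (suc n)
        ≡⟨ cong (count _) (m∸n+n≡m (m≤n⇒m≤1+n t≤n)) ⟨
      count (λ p → (p <ᵇ t) ∧ inArc-t p) (suc n ∸ t + t)
        ≡⟨ count-<ᵇ inArc-t t (suc n ∸ t) ⟩
      count inArc-t t
        ∎
      where open ≡-Reasoning

  open GreedyPaths n arc arc-0-0 out-half arc-suc in-half public

  toDisjointTwoOutPaths : ∀ {s k} {S : Fin (suc n) → Set} (P : Paths s) → k ≤ Paths.size P →
    (∀ w → s < toℕ (Inverse.from σ w) → S w) → DisjointTwoOutPaths T k (v zero) S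
  toDisjointTwoOutPaths {s} {k} P k≤size above⇒S = record
    { mid           = λ a → v (pos (mid (ι a)))
    ; term          = λ a → v (pos (term (ι a)))
    ; arc₁          = λ a → out-mid (ι a)
    ; arc₂          = λ a → arc-mid-term (ι a)
    ; termNotOrigin = λ a e → <⇒≢ (<-≤-trans z<s (t<term (ι a))) (sym (v∘pos-injective (term<n _) z<s e))
    ; midDistinct   = λ a b e → ι-injective a b (mid-injective _ _ (v∘pos-injective (mid<n _) (mid<n _) e))
    ; midNotTerm    = λ a b e → ⊥-elim (mid≢term _ _ (v∘pos-injective (mid<n _) (term<n _) e))
    ; termDistinct  = λ a b e → ι-injective a b (term-injective _ _ (v∘pos-injective (term<n _) (term<n _) e))
    ; termIn        = λ a → above⇒S _ (subst (s <_) (sym (from-v∘pos (term<n _))) (t<term (ι a)))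
    }
    where
    open Paths P
    ι : Fin k → Fin size
    ι a = inject≤ a k≤size
    ι-injective : ∀ a b → ι a ≡ ι b → a ≡ b
    ι-injective = inject≤-injective k≤size k≤size
    term<n : ∀ i → term i < suc n
    term<n i = s≤s (term≤n i)
    mid<n : ∀ i → mid i < suc n
    mid<n i = <-trans (mid<term i) (term<n i)
    from-v∘pos : ∀ {p} → p < suc n → toℕ (Inverse.from σ (v (pos p))) ≡ p
    from-v∘pos p<n = trans (cong toℕ (Inverse.strictlyInverseʳ σ _)) (toℕ-pos p<n)

≤4a+3⇒≤a : ∀ {s k a n} → s + 4 * k ≡ suc n → n ≤ s + 4 * a + 2 → k ≤ a
≤4a+3⇒≤a {s} {k} {a} {n} eq n≤ = ≤-pred (*-cancelˡ-< 4 k (suc a) (+-cancelˡ-≤ s _ _ (begin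
  s + suc (4 * k)         ≡⟨ +-suc s (4 * k) ⟩
  suc (s + 4 * k)         ≡⟨ cong suc eq ⟩
  suc (suc n)             ≤⟨ s≤s (s≤s n≤) ⟩
  suc (suc (s + 4 * a + 2)) ≡⟨ shift s a ⟩
  s + 4 * suc a           ∎)))
  where
  open ≤-Reasoning
  shift : ∀ s a → suc (suc (s + 4 * a + 2)) ≡ s + 4 * suc a
  shift = solve-∀

mainTheorem13 : (k m : ℕ) → (hk : 1 ≤ k) → (hm : 4 * k ≤ m) →
    (T : Tournament m) → (σ : Ordering m) → IsLocalMedianOrder T σ →
    DisjointTwoOutPaths T k (Inverse.to σ (fromℕ< {0} (≤-trans hk (≤-trans (m≤n*m k 4) hm))))
      (λ u → m ∸ 4 * k + 1 ≤ toℕ (Inverse.from σ u))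
mainTheorem13 k zero    hk hm T σ lmo = contradiction (≤-trans hk (≤-trans (m≤n*m k 4) hm)) λ ()
mainTheorem13 k (suc n) hk hm T σ lmo =
  toDisjointTwoOutPaths P (≤4a+3⇒≤a {s} (m∸n+n≡m hm) n≤) (λ w → ≤-trans (≤-reflexive (+-comm s 1)))
  where
  open LocalMedianOrder T σ lmo
  s : ℕ
  s = suc n ∸ 4 * k
  s≤n : s ≤ n
  s≤n = ∸-monoʳ-≤ (suc n) (≤-trans hk (m≤n*m k 4))
  P : Paths s
  P = proj₁ (paths-above s≤n)
  n≤ : n ≤ s + 4 * Paths.size P + 2
  n≤ = proj₂ (paths-above s≤n)
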